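{- Let $S=(s_i)$ be an orientable sequence of order $n$ and period $m$ such that the all-ones tuple $1^{n-4}$ occurs exactly once in a period (i.e. there is exactly one $i$ modulo $m$ with $\mathbf{s}_{n-4}(i)=1^{n-4}$). Then $\mathcal{E}(S)$ is an orientable sequence of order $n$ of odd weight, whose period is $m$ if $w(S)$ is odd and $m+1$ if $w(S)$ is even.
   Context: A periodic binary sequence $S=(s_i)$ has period $m$ = least $m>0$ with $s_{i+m}=s_i$ for all $i$; its generating cycle $[s_0,\dots,s_{m-1}]$ determines it. $\mathbf{s}_k(i)=(s_i,\dots,s_{i+k-1})$; $1^k$ denotes the tuple of $k$ ones. The weight is $w(S)=\sum_{i=0}^{m-1}s_i$. The reverse of a tuple $(u_0,\dots,u_{n-1})$ is $(u_{n-1},\dots,u_0)$, written $\mathbf{u}^R$. An orientable sequence of order $n$ is a periodic binary sequence of period $m$ such that $\mathbf{s}_n(i)=\mathbf{s}_n(j)$ implies $i\equiv j\pmod m$, and $\mathbf{s}_n(i)\ne\mathbf{s}_n(j)^R$ for all $i,j$. The extension map $\mathcal{E}$: for an orientable sequence $S$ of order $n$ and period $m$ containing exactly one occurrence of $1^{n-4}$ per period, if $w(S)$ is odd then $\mathcal{E}(S)=S$; if $w(S)$ is even, write the generating cycle as $[s_0,\dots,s_{m-1}]$ with $s_r=s_{r+1}=\dots=s_{r+n-5}=1$ for some $r$ (the unique run), and let $\mathcal{E}(S)$ be the periodic sequence with generating cycle $[s_0,\dots,s_{r-1},1,s_r,s_{r+1},\dots,s_{m-1}]$, i.e. the unique occurrence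 of $1^{n-4}$ is replaced by $1^{n-3}$. -}

module Defs where

open import Data.Bool using (Bool; true; false; if_then_else_)
open import Data.Nat using (ℕ; zero; suc; _+_; _∸_; _<_; _<ᵇ_; _≡ᵇ_; _%_)
open import Data.Nat.DivMod using ()
open import Data.Fin using (Fin; toℕ)
open import Data.Vec using (Vec; tabulate; reverse; replicate)
open import Data.List using (upTo; map)
open import Data.Nat.ListAction using (sum)
open import Relation.Binary.PropositionalEquality using (_≡_; _≢_)
open import Relation.Nullary using (¬_)
open import Data.Product using (_×_)

BinSeq : Set
BinSeq = ℕ → Bool

IsPeriod : BinSeq → ℕ → Set
IsPeriod s k = ∀ i → s (i + k) ≡ s i

HasPeriod : BinSeq → ℕ → Set
HasPeriod s m = (0 < m) × IsPeriod s m × (∀ k → 0 < k → k < m → ¬ IsPeriod s k)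

window : BinSeq → (k : ℕ) → ℕ → Vec Bool k
window s k i = tabulate (λ j → s (i + toℕ j))

Orientable : ℕ → ℕ → BinSeq → Set
Orientable n m s =
  HasPeriod s m ×
  (∀ i j → window s n i ≡ window s n j → i % suc (m ∸ 1) ≡ j % suc (m ∸ 1)) ×
  (∀ i j → window s n i ≢ reverse (window s n j))

bit : Bool → ℕ
bit true = 1
bit false = 0

weight : BinSeq → ℕ → ℕ
weight s m = sum (map (λ i → bit (s i)) (upTo m))

ones : (k : ℕ) → Vec Bool k
ones k = replicate k true

-- Insert a 1 before position r of the generating cycle [s_0,...,s_{m-1}]:
-- the periodic sequence with cycle [s_0,...,s_{r-1},1,s_r,...,s_{m-1}] (period m+1).
insertOne : BinSeq → ℕ → ℕ → BinSeq
insertOne s m r i =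
  let j = i % suc m in
  if j <ᵇ r then s j else (if j ≡ᵇ r then true else s (j ∸ 1))

-- The extension map E, given the position r (0 ≤ r < m) of the unique
-- occurrence of 1^{n-4} in the generating cycle.
ext : BinSeq → ℕ → ℕ → BinSeq
ext s m r = if weight s m % 2 ≡ᵇ 1 then s else insertOne s m r

{-# OPTIONS --safe #-}
module Submission where

-- Rotate S so that its unique run 1^(n-4) starts at 0 (call it v), and E(S) so that it starts at
-- the inserted 1 (call it u): the cycle of u is 1 followed by the cycle of v. The window of v at
-- m - 2 reads c 0 1^(n-4) 0 c' with c ≠ c', for otherwise it would be a palindrome; this also
-- forces m ≥ n. Since v contains no 1^(n-3), the run 1^(n-3) occurs in u only at 0. So the
-- n-windows of u starting at 1, ..., m - 3 are windows of v, and the remaining four, starting at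
-- -3, ..., 0, contain 1^(n-3) at offsets 3, ..., 0. A coincidence or reversal involving one of
-- these four would move 1^(n-3) elsewhere or change its offset, except for a reversal between
-- offsets 0 and 3 or 1 and 2, which would equate c and c'. The inserted 1 makes the weight odd.

open import Defs
open import Data.Bool using (true; false; if_then_else_)
open import Data.Bool.Properties using (¬-not)
open import Data.Empty using (⊥; ⊥-elim)
open import Data.Nat
open import Data.Nat.Properties
open import Data.Nat.DivMod
open import Data.Fin using (Fin; toℕ; fromℕ<; fromℕ; inject₁; opposite)
  renaming (zero to fzero; suc to fsuc)
open import Data.Fin.Properties using (toℕ<n; toℕ-fromℕ<; opposite-prop; opposite-involutive)
open import Data.Vec using (Vec; []; _∷_; _∷ʳ_; lookup; reverse)
open import Data.Vec.Properties using (lookup∘tabulate; tabulate∘lookup; tabulate-cong; reverse-∷; lookup-replicate)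
open import Data.Product using (_×_; _,_)
open import Data.Sum using (inj₁; inj₂)
open import Relation.Binary.Definitions using (tri<; tri≈; tri>)
open import Function.Bundles using (_⇔_; mk⇔; Equivalence)
open import Function.Properties.Equivalence using () renaming (trans to ⇔-trans; sym to ⇔-sym)
open import Relation.Nullary using (¬_; yes; no)
open import Relation.Nullary.Decidable using (dec-true; dec-false)
open import Data.List as List using (applyUpTo)
open import Data.List.Properties using (map-applyUpTo)
open import Data.Nat.ListAction using (sum)
open import Relation.Binary.PropositionalEquality

private
  variable
    A : Set
    s : BinSeq
    n k x i j : ℕ

-- Windows and runs

lookup-∷ʳ-last : (xs : Vec A n) (y : A) → lookup (xs ∷ʳ y) (fromℕ n) ≡ y
lookup-∷ʳ-last []       y = refl
lookup-∷ʳ-last (x ∷ xs) y = lookup-∷ʳ-last xs y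

lookup-∷ʳ-inject₁ : (xs : Vec A n) (y : A) (i : Fin n) → lookup (xs ∷ʳ y) (inject₁ i) ≡ lookup xs i
lookup-∷ʳ-inject₁ (x ∷ xs) y fzero    = refl
lookup-∷ʳ-inject₁ (x ∷ xs) y (fsuc i) = lookup-∷ʳ-inject₁ xs y i

lookup-reverse-opposite : (xs : Vec A n) (i : Fin n) → lookup (reverse xs) (opposite i) ≡ lookup xs i
lookup-reverse-opposite (x ∷ xs) fzero rewrite reverse-∷ x xs = lookup-∷ʳ-last (reverse xs) x
lookup-reverse-opposite (x ∷ xs) (fsuc i) rewrite reverse-∷ x xs =
  trans (lookup-∷ʳ-inject₁ (reverse xs) x (opposite i)) (lookup-reverse-opposite xs i)

lookup-reverse : (xs : Vec A n) (i : Fin n) → lookup (reverse xs) i ≡ lookup xs (opposite i)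
lookup-reverse xs i =
  trans (cong (lookup (reverse xs)) (sym (opposite-involutive i))) (lookup-reverse-opposite xs (opposite i))

SameWindow : BinSeq → ℕ → ℕ → ℕ → Set
SameWindow s n i j = ∀ k → k < n → s (i + k) ≡ s (j + k)

ReversedWindow : BinSeq → ℕ → ℕ → ℕ → Set
ReversedWindow s n i j = ∀ k → k < n → s (i + k) ≡ s (j + (n ∸ suc k))

Run : BinSeq → ℕ → ℕ → Set
Run s k x = ∀ j → j < k → s (x + j) ≡ true

lookup-window : ∀ s x (i : Fin n) → lookup (window s n x) i ≡ s (x + toℕ i)
lookup-window s x i = lookup∘tabulate _ i

lookup-window-fromℕ< : ∀ s x (k<n : k < n) → lookup (window s n x) (fromℕ< k<n) ≡ s (x + k)
lookup-window-fromℕ< s x k<n =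
  trans (lookup-window s x (fromℕ< k<n)) (cong (λ k → s (x + k)) (toℕ-fromℕ< k<n))

window-≡⇒SameWindow : ∀ s → window s n i ≡ window s n j → SameWindow s n i j
window-≡⇒SameWindow {i = i} {j} s eq k k<n =
  trans (sym (lookup-window-fromℕ< s i k<n))
        (trans (cong (λ w → lookup w (fromℕ< k<n)) eq) (lookup-window-fromℕ< s j k<n))

SameWindow⇒window-≡ : ∀ s → SameWindow s n i j → window s n i ≡ window s n j
SameWindow⇒window-≡ s same = tabulate-cong (λ k → same (toℕ k) (toℕ<n k))

lookup-reverse-window : ∀ s x (k : Fin n) → lookup (reverse (window s n x)) k ≡ s (x + (n ∸ suc (toℕ k)))
lookup-reverse-window {n} s x k =
  trans (lookup-reverse (window s n x) k)
        (trans (lookup-window s x (opposite k)) (cong (λ k → s (x + k)) (opposite-prop k)))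

window-reverse⇒ReversedWindow : ∀ s → window s n i ≡ reverse (window s n j) → ReversedWindow s n i j
window-reverse⇒ReversedWindow {n} {i} {j} s eq k k<n =
  trans (sym (lookup-window-fromℕ< s i k<n))
        (trans (cong (λ w → lookup w (fromℕ< k<n)) eq)
               (trans (lookup-reverse-window s j (fromℕ< k<n))
                      (cong (λ k → s (j + (n ∸ suc k))) (toℕ-fromℕ< k<n))))

ReversedWindow⇒window-reverse : ∀ s → ReversedWindow s n i j → window s n i ≡ reverse (window s n j)
ReversedWindow⇒window-reverse {n} {i} {j} s rev =
  trans (tabulate-cong (λ k → trans (rev (toℕ k) (toℕ<n k)) (sym (lookup-reverse-window s j k))))
        (tabulate∘lookup (reverse (window s n j)))

window-ones⇔Run : ∀ s → window s k x ≡ ones k ⇔ Run s k x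
window-ones⇔Run {k} {x} s = mk⇔
  (λ eq j j<k → trans (sym (lookup-window-fromℕ< s x j<k))
                      (trans (cong (λ w → lookup w (fromℕ< j<k)) eq) (lookup-replicate (fromℕ< j<k) true)))
  (λ run → trans (tabulate-cong (λ j → trans (run (toℕ j) (toℕ<n j)) (sym (lookup-replicate j true))))
                 (tabulate∘lookup (ones k)))

reflect-< : k < n → n ∸ suc k < n
reflect-< {k} {suc n} _ = s≤s (m∸n≤m n k)

reflect-involutive : k < n → n ∸ suc (n ∸ suc k) ≡ k
reflect-involutive (s≤s k≤n) = m∸[m∸n]≡n k≤n

SameWindow-sym : ∀ s → SameWindow s n i j → SameWindow s n j i
SameWindow-sym s same k k<n = sym (same k k<n)

ReversedWindow-sym : ∀ s → ReversedWindow s n i j → ReversedWindow s n j i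
ReversedWindow-sym {n} {i} {j} s rev k k<n =
  sym (trans (rev (n ∸ suc k) (reflect-< k<n)) (cong (λ l → s (j + l)) (reflect-involutive k<n)))

SameWindow-Run : ∀ s e → SameWindow s n i j → e + k ≤ n → Run s k (j + e) → Run s k (i + e)
SameWindow-Run {n} {i} {j} s e same e+k≤n run l l<k = begin
  s (i + e + l)   ≡⟨ cong s (+-assoc i e l) ⟩
  s (i + (e + l)) ≡⟨ same (e + l) (<-≤-trans (+-monoʳ-< e l<k) e+k≤n) ⟩
  s (j + (e + l)) ≡⟨ cong s (+-assoc j e l) ⟨
  s (j + e + l)   ≡⟨ run l l<k ⟩
  true            ∎
  where open ≡-Reasoning

ReversedWindow-Run : ∀ s e → ReversedWindow s n i j → e + k ≤ n →
                     Run s k (j + e) → Run s k (i + (n ∸ (e + k)))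
ReversedWindow-Run {n} {i} {j} {k} s e rev e+k≤n run l l<k = begin
  s (i + d + l)                  ≡⟨ cong s (+-assoc i d l) ⟩
  s (i + (d + l))                ≡⟨ rev (d + l) d+l<n ⟩
  s (j + (n ∸ suc (d + l)))      ≡⟨ cong (λ x → s (j + x)) reflected ⟩
  s (j + (e + (k ∸ suc l)))      ≡⟨ cong s (+-assoc j e _) ⟨
  s (j + e + (k ∸ suc l))        ≡⟨ run (k ∸ suc l) (reflect-< l<k) ⟩
  true                           ∎
  where
  open ≡-Reasoning
  d : ℕ
  d = n ∸ (e + k)
  n≡d+[e+k] : n ≡ d + (e + k)
  n≡d+[e+k] = sym (m∸n+n≡m e+k≤n)
  d+l<n : d + l < n
  d+l<n = subst (d + l <_) (sym n≡d+[e+k]) (+-monoʳ-< d (<-≤-trans l<k (m≤n+m k e)))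
  reflected : n ∸ suc (d + l) ≡ e + (k ∸ suc l)
  reflected = begin
    n ∸ suc (d + l)         ≡⟨ cong₂ _∸_ n≡d+[e+k] (sym (+-suc d l)) ⟩
    d + (e + k) ∸ (d + suc l) ≡⟨ [m+n]∸[m+o]≡n∸o d (e + k) (suc l) ⟩
    e + k ∸ suc l           ≡⟨ +-∸-assoc e l<k ⟩
    e + (k ∸ suc l)         ∎

Run-snoc : ∀ s → Run s k x → s (x + k) ≡ true → Run s (suc k) x
Run-snoc {k} s run last j j<1+k with m≤n⇒m<n∨m≡n (s≤s⁻¹ j<1+k)
... | inj₁ j<k  = run j j<k
... | inj₂ refl = last

Run-cons : ∀ s → s x ≡ true → Run s k (suc x) → Run s (suc k) x
Run-cons {x} s first run zero _ = trans (cong s (+-identityʳ x)) first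
Run-cons {x} s first run (suc j) (s≤s j<k) = trans (cong s (+-suc x j)) (run j j<k)

Run-init : ∀ s → Run s (suc k) x → Run s k x
Run-init s run j j<k = run j (m<n⇒m<1+n j<k)

Run-tail : ∀ s → Run s (suc k) x → Run s k (suc x)
Run-tail {x = x} s run j j<k = trans (cong s (sym (+-suc x j))) (run (suc j) (s<s j<k))

Run-rotate : ∀ s r → Run (λ y → s (r + y)) k x ⇔ Run s k (r + x)
Run-rotate {x = x} s r = mk⇔
  (λ run j j<k → trans (cong s (+-assoc r x j)) (run j j<k))
  (λ run j j<k → trans (cong s (sym (+-assoc r x j))) (run j j<k))

-- Arithmetic modulo the period

%-congˡ-+ : ∀ M .{{_ : NonZero M}} k → x % M ≡ i % M → (x + k) % M ≡ (i + k) % M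
%-congˡ-+ {x} {i} M k eq = begin
  (x + k) % M         ≡⟨ %-distribˡ-+ x k M ⟩
  (x % M + k % M) % M ≡⟨ cong (λ z → (z + k % M) % M) eq ⟩
  (i % M + k % M) % M ≡⟨ %-distribˡ-+ i k M ⟨
  (i + k) % M         ∎
  where open ≡-Reasoning

%-congʳ-+ : ∀ M .{{_ : NonZero M}} k → x % M ≡ i % M → (k + x) % M ≡ (k + i) % M
%-congʳ-+ {x} {i} M k eq =
  subst₂ (λ a b → a % M ≡ b % M) (+-comm x k) (+-comm i k) (%-congˡ-+ M k eq)

-- Adding k * (M - 1) undoes adding k, modulo M.
%-cancelʳ-+ : ∀ M .{{_ : NonZero M}} k → (x + k) % M ≡ (i + k) % M → x % M ≡ i % M
%-cancelʳ-+ {x} {i} M k eq = begin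
  x % M                    ≡⟨ [m+kn]%n≡m%n x k M ⟨
  (x + k * M) % M          ≡⟨ cong (_% M) (undo x) ⟩
  (x + k + k * pred M) % M ≡⟨ %-congˡ-+ M (k * pred M) eq ⟩
  (i + k + k * pred M) % M ≡⟨ cong (_% M) (undo i) ⟨
  (i + k * M) % M          ≡⟨ [m+kn]%n≡m%n i k M ⟩
  i % M                    ∎
  where
  open ≡-Reasoning
  undo : ∀ z → z + k * M ≡ z + k + k * pred M
  undo z = begin
    z + k * M              ≡⟨ cong (λ w → z + k * w) (suc-pred M) ⟨
    z + k * suc (pred M)   ≡⟨ cong (z +_) (*-suc k (pred M)) ⟩
    z + (k + k * pred M)   ≡⟨ +-assoc z k _ ⟨
    z + k + k * pred M     ∎

%-cancelˡ-+ : ∀ M .{{_ : NonZero M}} k → (k + x) % M ≡ (k + i) % M → x % M ≡ i % M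
%-cancelˡ-+ {x} {i} M k eq =
  %-cancelʳ-+ M k (subst₂ (λ a b → a % M ≡ b % M) (+-comm k x) (+-comm k i) eq)

%-injective : ∀ {M} .{{_ : NonZero M}} → i < M → j < M → i % M ≡ j % M → i ≡ j
%-injective i<M j<M eq = trans (sym (m<n⇒m%n≡m i<M)) (trans eq (m<n⇒m%n≡m j<M))

0%n≡0 : ∀ n .{{_ : NonZero n}} → 0 % n ≡ 0
0%n≡0 n = m<n⇒m%n≡m (>-nonZero⁻¹ n)

rotate-residue : ∀ {m} .{{_ : NonZero m}} {r} → r < m → (r + x) % m ≡ r ⇔ x % m ≡ 0
rotate-residue {x} {m} {r} r<m = mk⇔
  (λ eq → trans (%-cancelˡ-+ m r (trans eq (sym r+0%m≡r))) (0%n≡0 m))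
  (λ eq → trans (%-congʳ-+ m r (trans eq (sym (0%n≡0 m)))) r+0%m≡r)
  where
  r+0%m≡r : (r + 0) % m ≡ r
  r+0%m≡r = trans (cong (_% m) (+-identityʳ r)) (m<n⇒m%n≡m r<m)

module _ {M} .{{_ : NonZero M}} (per : IsPeriod s M) where

  IsPeriod-+* : ∀ x q → s (x + q * M) ≡ s x
  IsPeriod-+* x zero    = cong s (+-identityʳ x)
  IsPeriod-+* x (suc q) = trans (cong s (sym (+-assoc x M (q * M))))
                                (trans (IsPeriod-+* (x + M) q) (per x))

  IsPeriod-% : ∀ x → s (x % M) ≡ s x
  IsPeriod-% x = trans (sym (IsPeriod-+* (x % M) (x / M))) (cong s (sym (m≡m%n+[m/n]*n x M)))

  IsPeriod-cong : x % M ≡ i % M → s x ≡ s i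
  IsPeriod-cong {x} {i} eq = trans (sym (IsPeriod-% x)) (trans (cong s eq) (IsPeriod-% i))

  IsPeriod-%-+ : ∀ x k → s (x % M + k) ≡ s (x + k)
  IsPeriod-%-+ x k = IsPeriod-cong (%-congˡ-+ M k (m%n%n≡m%n x M))

IsPeriod-rotate : ∀ {m} r → IsPeriod s m → IsPeriod (λ x → s (r + x)) m
IsPeriod-rotate {s} {m} r per x = trans (cong s (sym (+-assoc r x m))) (per (r + x))

IsPeriod-1-constant : ∀ s → IsPeriod s 1 → ∀ x → s x ≡ s 0
IsPeriod-1-constant s per zero    = refl
IsPeriod-1-constant s per (suc x) = trans (cong s (+-comm 1 x)) (trans (per x) (IsPeriod-1-constant s per x))

-- Orientability

orientable-from-residues : ∀ {m} → IsPeriod s (suc m) →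
  (∀ {i j} → i < suc m → j < suc m → SameWindow s n i j → i ≡ j) →
  (∀ {i j} → i < suc m → j < suc m → ¬ ReversedWindow s n i j) →
  Orientable n (suc m) s
orientable-from-residues {s} {n} {m} per distinct asym =
  (z<s , per , least) , windows-distinct , no-reversal
  where
  M : ℕ
  M = suc m
  windows-distinct : ∀ i j → window s n i ≡ window s n j → i % M ≡ j % M
  windows-distinct i j eq = distinct (m%n<n i M) (m%n<n j M) λ k k<n →
    trans (IsPeriod-%-+ per i k)
          (trans (window-≡⇒SameWindow s eq k k<n) (sym (IsPeriod-%-+ per j k)))
  no-reversal : ∀ i j → window s n i ≢ reverse (window s n j)
  no-reversal i j eq = asym (m%n<n i M) (m%n<n j M) λ k k<n →
    trans (IsPeriod-%-+ per i k)
          (trans (window-reverse⇒ReversedWindow s eq k k<n) (sym (IsPeriod-%-+ per j (n ∸ suc k))))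
  least : ∀ k → 0 < k → k < M → ¬ IsPeriod s k
  least k 0<k k<M per-k =
    <⇒≢ 0<k (sym (distinct k<M z<s λ l _ → trans (cong s (+-comm k l)) (per-k l)))

orientable⇒SameWindow-residue : ∀ {m} → Orientable n (suc m) s → SameWindow s n i j → i % suc m ≡ j % suc m
orientable⇒SameWindow-residue {s = s} {i = i} {j} (_ , distinct , _) same = distinct i j (SameWindow⇒window-≡ s same)

orientable⇒¬ReversedWindow : ∀ {m} → Orientable n m s → ¬ ReversedWindow s n i j
orientable⇒¬ReversedWindow {s = s} {i = i} {j} (_ , _ , asym) rev = asym i j (ReversedWindow⇒window-reverse s rev)

1<period : ∀ {m} .{{_ : NonZero m}} → IsPeriod s m → (∀ i j → ¬ ReversedWindow s n i j) → 1 < m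
1<period {s} {m = m} per asym = ≰⇒> λ m≤1 → asym 0 0 λ k _ →
  trans (constant m≤1 k) (sym (constant m≤1 _))
  where
  constant : m ≤ 1 → ∀ x → s x ≡ s 0
  constant m≤1 = IsPeriod-1-constant s (subst (IsPeriod s) (≤-antisym m≤1 (>-nonZero⁻¹ m)) per)

orientable-rotate : ∀ {t m} r → IsPeriod t (suc m) → (∀ x → t x ≡ s (r + x)) →
                    Orientable n (suc m) s → Orientable n (suc m) t
orientable-rotate {s} {n} {t} {m} r per-t t≡s s-orientable =
  orientable-from-residues per-t distinct asym
  where
  M : ℕ
  M = suc m
  shifted : ∀ i k → t (i + k) ≡ s (r + i + k)
  shifted i k = trans (t≡s (i + k)) (cong s (sym (+-assoc r i k)))
  residue : ∀ {i j} → i < M → j < M → (r + i) % M ≡ (r + j) % M → i ≡ j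
  residue i<M j<M eq = %-injective i<M j<M (%-cancelˡ-+ M r eq)
  distinct : ∀ {i j} → i < M → j < M → SameWindow t n i j → i ≡ j
  distinct {i} {j} i<M j<M same = residue i<M j<M (orientable⇒SameWindow-residue s-orientable λ k k<n →
    trans (sym (shifted i k)) (trans (same k k<n) (shifted j k)))
  asym : ∀ {i j} → i < M → j < M → ¬ ReversedWindow t n i j
  asym {i} {j} _ _ rev = orientable⇒¬ReversedWindow s-orientable λ k k<n →
    trans (sym (shifted i k)) (trans (rev k k<n) (shifted j (n ∸ suc k)))

empty-run-not-unique : ∀ {m} .{{_ : NonZero m}} {r} → 1 < m → r < m →
                       ¬ (∀ i → window s 0 i ≡ ones 0 ⇔ i % m ≡ r)
empty-run-not-unique {m = m} {r} 1<m r<m unique = 1+n≢0 (trans (sym (m<n⇒m%n≡m 1<m))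
  (Equivalence.to (rotate-residue r<m) (Equivalence.to (unique (r + 1)) refl)))

-- Inserting a one

<ᵇ-true : i < j → (i <ᵇ j) ≡ true
<ᵇ-true {i} {j} = dec-true (i <? j)

<ᵇ-false : ¬ i < j → (i <ᵇ j) ≡ false
<ᵇ-false {i} {j} = dec-false (i <? j)

≡ᵇ-true : i ≡ j → (i ≡ᵇ j) ≡ true
≡ᵇ-true {i} {j} = dec-true (i ≟ j)

≡ᵇ-false : i ≢ j → (i ≡ᵇ j) ≡ false
≡ᵇ-false {i} {j} = dec-false (i ≟ j)

module _ (s : BinSeq) (m r : ℕ) where

  insertOne-periodic : IsPeriod (insertOne s m r) (suc m)
  insertOne-periodic i =
    cong (λ j → if j <ᵇ r then s j else (if j ≡ᵇ r then true else s (j ∸ 1))) ([m+n]%n≡m%n i (suc m))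

  insertOne-< : i < r → r ≤ m → insertOne s m r i ≡ s i
  insertOne-< i<r r≤m rewrite m≤n⇒m%n≡m (≤-trans (<⇒≤ i<r) r≤m) | <ᵇ-true i<r = refl

  insertOne-≡ : r ≤ m → insertOne s m r r ≡ true
  insertOne-≡ r≤m rewrite m≤n⇒m%n≡m r≤m | <ᵇ-false (n≮n r) | ≡ᵇ-true {r} refl = refl

  insertOne-> : r ≤ i → i < m → insertOne s m r (suc i) ≡ s i
  insertOne-> r≤i i<m
    rewrite m≤n⇒m%n≡m i<m | <ᵇ-false (≤⇒≯ (m≤n⇒m≤1+n r≤i)) | ≡ᵇ-false (λ eq → <⇒≢ (s≤s r≤i) (sym eq)) = refl

module _ {s m r} (per : IsPeriod s m) (r<m : r < m) where

  insertOne-rotated-zero : insertOne s m r (r + 0) ≡ true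
  insertOne-rotated-zero = trans (cong (insertOne s m r) (+-identityʳ r)) (insertOne-≡ s m r (<⇒≤ r<m))

  insertOne-rotated-suc : x < m → insertOne s m r (r + suc x) ≡ s (r + x)
  insertOne-rotated-suc {x} x<m with r + x <? m
  ... | yes r+x<m = trans (cong (insertOne s m r) (+-suc r x)) (insertOne-> s m r (m≤m+n r x) r+x<m)
  ... | no r+x≮m = begin
    insertOne s m r (r + suc x)   ≡⟨ cong (insertOne s m r) r+1+x≡y+M ⟩
    insertOne s m r (y + suc m)   ≡⟨ insertOne-periodic s m r y ⟩
    insertOne s m r y             ≡⟨ insertOne-< s m r y<r (<⇒≤ r<m) ⟩
    s y                           ≡⟨ per y ⟨
    s (y + m)                     ≡⟨ cong s y+m≡r+x ⟩
    s (r + x)                     ∎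
    where
    open ≡-Reasoning
    y : ℕ
    y = r + x ∸ m
    y+m≡r+x : y + m ≡ r + x
    y+m≡r+x = m∸n+n≡m (≮⇒≥ r+x≮m)
    r+1+x≡y+M : r + suc x ≡ y + suc m
    r+1+x≡y+M = trans (+-suc r x) (trans (cong suc (sym y+m≡r+x)) (sym (+-suc y m)))
    y<r : y < r
    y<r = +-cancelʳ-< m y r (subst (_< r + m) (sym y+m≡r+x) (+-monoʳ-< r x<m))

applyUpTo-cong : ∀ {f g : ℕ → A} k → (∀ i → i < k → f i ≡ g i) → applyUpTo f k ≡ applyUpTo g k
applyUpTo-cong zero    _  = refl
applyUpTo-cong (suc k) eq = cong₂ List._∷_ (eq 0 z<s) (applyUpTo-cong k (λ i i<k → eq (suc i) (s<s i<k)))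

sum-applyUpTo-insert : ∀ {f g : ℕ → ℕ} r k → r ≤ k →
  (∀ i → i < r → f i ≡ g i) → f r ≡ 1 → (∀ i → r ≤ i → i < k → f (suc i) ≡ g i) →
  sum (applyUpTo f (suc k)) ≡ suc (sum (applyUpTo g k))
sum-applyUpTo-insert zero k _ _ f0≡1 above =
  cong₂ _+_ f0≡1 (cong sum (applyUpTo-cong k (λ i → above i z≤n)))
sum-applyUpTo-insert {f} {g} (suc r) (suc k) (s≤s r≤k) below fr≡1 above =
  trans (cong₂ _+_ (below 0 z<s)
                   (sum-applyUpTo-insert r k r≤k (λ i i<r → below (suc i) (s<s i<r)) fr≡1
                                         (λ i r≤i i<k → above (suc i) (s≤s r≤i) (s<s i<k))))
        (+-suc (g 0) _)

weight-applyUpTo : ∀ s m → weight s m ≡ sum (applyUpTo (λ i → bit (s i)) m)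
weight-applyUpTo s m = cong sum (map-applyUpTo (λ i → i) (λ i → bit (s i)) m)

weight-insertOne : ∀ s m r → r ≤ m → weight (insertOne s m r) (suc m) ≡ suc (weight s m)
weight-insertOne s m r r≤m = begin
  weight (insertOne s m r) (suc m)                          ≡⟨ weight-applyUpTo _ (suc m) ⟩
  sum (applyUpTo (λ i → bit (insertOne s m r i)) (suc m))   ≡⟨ inserted ⟩
  suc (sum (applyUpTo (λ i → bit (s i)) m))                 ≡⟨ cong suc (weight-applyUpTo s m) ⟨
  suc (weight s m)                                          ∎
  where
  open ≡-Reasoning
  inserted : sum (applyUpTo (λ i → bit (insertOne s m r i)) (suc m)) ≡ suc (sum (applyUpTo (λ i → bit (s i)) m))
  inserted = sum-applyUpTo-insert r m r≤m
    (λ i i<r → cong bit (insertOne-< s m r i<r r≤m)) (cong bit (insertOne-≡ s m r r≤m))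
    (λ i r≤i i<m → cong bit (insertOne-> s m r r≤i i<m))

even⇒suc-odd : x % 2 ≡ 0 → suc x % 2 ≡ 1
even⇒suc-odd {x} even = trans (%-distribˡ-+ 1 x 2) (cong (λ r → (1 + r) % 2) even)

-- v is S rotated so that its run 1^L starts at 0, and u is E(S) rotated so that it starts
-- at the inserted 1: the generating cycle of u is 1 followed by that of v.
module Extension {L m : ℕ} .{{_ : NonZero m}} {v u : BinSeq}
  (v-periodic : IsPeriod v m)
  (v-distinct : ∀ i j → SameWindow v (4 + L) i j → i % m ≡ j % m)
  (v-asym : ∀ i j → ¬ ReversedWindow v (4 + L) i j)
  (v-run : ∀ x → Run v L x ⇔ x % m ≡ 0)
  (u-periodic : IsPeriod u (suc m))
  (u-zero : u 0 ≡ true)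
  (u-suc : ∀ x → x < m → u (suc x) ≡ v x)
  where

  open Equivalence

  1<m : 1 < m
  1<m = 1<period v-periodic v-asym

  v-run-zero : Run v L 0
  v-run-zero = from (v-run 0) (0%n≡0 m)

  v-run-period : Run v L m
  v-run-period = from (v-run m) (n%n≡0 m)

  no-long-run : ¬ Run v (suc L) x
  no-long-run {x} run = 1+n≢0 (begin
    1              ≡⟨ m<n⇒m%n≡m 1<m ⟨
    1 % m          ≡⟨ %-congˡ-+ m 1 (trans (to (v-run x) (Run-init v run)) (sym (0%n≡0 m))) ⟨
    (x + 1) % m    ≡⟨ cong (_% m) (+-comm x 1) ⟩
    suc x % m      ≡⟨ to (v-run (suc x)) (Run-tail v run) ⟩
    0              ∎)
    where open ≡-Reasoning

  v-after-run : v L ≡ false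
  v-after-run = ¬-not λ vL → no-long-run (Run-snoc v v-run-zero vL)

  v-before-run : v (pred m) ≡ false
  v-before-run = ¬-not λ v-pm →
    no-long-run (Run-cons v v-pm (subst (Run v L) (sym (suc-pred m)) v-run-period))

  suc[m∸2]≡pred[m] : suc (m ∸ 2) ≡ pred m
  suc[m∸2]≡pred[m] = cong pred (trans (+-comm 2 (m ∸ 2)) (m∸n+n≡m 1<m))

  -- Otherwise the window of v at m - 2, which reads  c 0 1^L 0 c,  would be a palindrome.
  v-ends-differ : v (m ∸ 2) ≢ v (suc L)
  v-ends-differ ends = v-asym p p palindrome
    where
    p : ℕ
    p = m ∸ 2
    p+2≡m : p + 2 ≡ m
    p+2≡m = m∸n+n≡m 1<m
    past-period : ∀ j → v (p + (2 + j)) ≡ v j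
    past-period j = trans (cong v (trans (sym (+-assoc p 2 j)) (cong (_+ j) p+2≡m)))
                          (trans (cong v (+-comm m j)) (v-periodic j))
    p+1 : v (p + 1) ≡ false
    p+1 = trans (cong v (trans (+-comm p 1) suc[m∸2]≡pred[m])) v-before-run
    middle : ∀ j → j < 2 + L → v (p + (2 + j)) ≡ v (p + (suc L ∸ j))
    middle j j<2+L with <-cmp j L
    ... | tri< j<L _ _ = trans (past-period j) (trans (v-run-zero j j<L) (sym (begin
      v (p + (suc L ∸ j))          ≡⟨ cong (λ i → v (p + i)) reflected ⟩
      v (p + (2 + (L ∸ suc j)))    ≡⟨ past-period (L ∸ suc j) ⟩
      v (L ∸ suc j)                ≡⟨ v-run-zero _ (reflect-< j<L) ⟩
      true                         ∎)))
      where
      open ≡-Reasoning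
      reflected : suc L ∸ j ≡ 2 + (L ∸ suc j)
      reflected = trans (+-∸-assoc 1 (<⇒≤ j<L)) (cong suc (+-∸-assoc 1 j<L))
    ... | tri≈ _ refl _ = trans (past-period L)
                                (trans v-after-run (sym (trans (cong (λ i → v (p + i)) (m+n∸n≡m 1 L)) p+1)))
    ... | tri> _ _ L<j with ≤-antisym (s≤s⁻¹ j<2+L) L<j
    ... | refl = trans (past-period (suc L))
                       (sym (trans (cong (λ i → v (p + i)) (n∸n≡0 (suc L))) (trans (cong v (+-identityʳ p)) ends)))
    palindrome : ReversedWindow v (4 + L) p p
    palindrome zero _ = trans (cong v (+-identityʳ p)) (trans ends (sym (past-period (suc L))))
    palindrome (suc zero) _ = trans p+1 (sym (trans (past-period L) v-after-run))
    palindrome (suc (suc j)) (s≤s (s≤s j<2+L)) = middle j j<2+L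

  period-not-short : ∀ d → m ≡ d + suc L → d ≤ 2 → ⊥
  period-not-short 0 m≡1+L _ = v-ends-differ (trans (cong (λ i → v (i ∸ 2)) m≡1+L)
    (trans (v-run-zero (L ∸ 1) L∸1<L) (sym (begin
    v (suc L)   ≡⟨ cong v m≡1+L ⟨
    v m         ≡⟨ v-periodic 0 ⟩
    v 0         ≡⟨ v-run-zero 0 0<L ⟩
    true        ∎))))
    where
    open ≡-Reasoning
    0<L : 0 < L
    0<L = s≤s⁻¹ (subst (1 <_) m≡1+L 1<m)
    L∸1<L : L ∸ 1 < L
    L∸1<L = ∸-monoʳ-< z<s 0<L
  period-not-short 1 m≡2+L _ = v-ends-differ (trans (cong (λ i → v (i ∸ 2)) m≡2+L)
    (trans v-after-run (sym (trans (cong (λ i → v (pred i)) (sym m≡2+L)) v-before-run))))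
  period-not-short 2 m≡3+L _ = v-ends-differ (cong (λ i → v (i ∸ 2)) m≡3+L)
  period-not-short (suc (suc (suc _))) _ (s≤s (s≤s ()))

  order≤period : 4 + L ≤ m
  order≤period with 4 + L ≤? m | m ≤? L
  ... | yes 4+L≤m | _ = 4+L≤m
  ... | no _ | yes m≤L = ⊥-elim (true≢false (begin
    true              ≡⟨ v-run-zero (L ∸ m) (∸-monoʳ-< (>-nonZero⁻¹ m) m≤L) ⟨
    v (L ∸ m)         ≡⟨ v-periodic (L ∸ m) ⟨
    v (L ∸ m + m)     ≡⟨ cong v (m∸n+n≡m m≤L) ⟩
    v L               ≡⟨ v-after-run ⟩
    false             ∎))
    where
    open ≡-Reasoning
    true≢false : true ≢ false
    true≢false ()
  ... | no 4+L≰m | no m≰L = ⊥-elim (period-not-short (m ∸ suc L) (sym (m∸n+n≡m (≰⇒> m≰L)))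
          (≤-trans (∸-monoˡ-≤ (suc L) (s≤s⁻¹ (≰⇒> 4+L≰m))) (≤-reflexive (m+n∸n≡m 2 (suc L)))))

  M : ℕ
  M = suc m

  L<m : L < m
  L<m = ≤-trans (m≤n+m (suc L) 3) order≤period

  offset<M : x ≤ 3 → x < M
  offset<M x≤3 = s≤s (≤-trans x≤3 (≤-trans (m≤m+n 3 L) (≤-trans (n≤1+n (3 + L)) order≤period)))

  u-run-zero : Run u (suc L) 0
  u-run-zero = Run-cons u u-zero λ j j<L → trans (u-suc j (<-trans j<L L<m)) (v-run-zero j j<L)

  u-suc-wrapped : x < m + L → u (suc x) ≡ v x
  u-suc-wrapped {x} x<m+L with x <? m
  ... | yes x<m = u-suc x x<m
  ... | no x≮m = begin
    u (suc x)    ≡⟨ cong u (trans (cong suc (sym y+m≡x)) (sym (+-suc y m))) ⟩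
    u (y + M)    ≡⟨ u-periodic y ⟩
    u y          ≡⟨ u-run-zero y (m<n⇒m<1+n y<L) ⟩
    true         ≡⟨ v-run-zero y y<L ⟨
    v y          ≡⟨ v-periodic y ⟨
    v (y + m)    ≡⟨ cong v y+m≡x ⟩
    v x          ∎
    where
    open ≡-Reasoning
    y : ℕ
    y = x ∸ m
    y+m≡x : y + m ≡ x
    y+m≡x = m∸n+n≡m (≮⇒≥ x≮m)
    y<L : y < L
    y<L = +-cancelʳ-< m y L (subst₂ _<_ (sym y+m≡x) (+-comm m L) x<m+L)

  u-run : Run u (suc L) x ⇔ x % M ≡ 0
  u-run {x} = mk⇔
    (λ run → residue (x % M) (m%n<n x M) λ j j<1+L → trans (IsPeriod-%-+ u-periodic x j) (run j j<1+L))
    (λ x≡0 j j<1+L → trans (sym (IsPeriod-%-+ u-periodic x j))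
                           (trans (cong (λ a → u (a + j)) x≡0) (u-run-zero j j<1+L)))
    where
    residue : ∀ a → a < M → Run u (suc L) a → a ≡ 0
    residue zero    _         _   = refl
    residue (suc b) (s≤s b<m) run = ⊥-elim (no-long-run λ j j<1+L →
      trans (sym (u-suc-wrapped (+-mono-<-≤ b<m (s≤s⁻¹ j<1+L)))) (run j j<1+L))

  -- A window of u either is a window of v moved one step to the right (old), or contains
  -- the run 1^(L+1) at offset e (new).
  data Position : ℕ → Set where
    old : ∀ b → 4 + b ≤ m → Position (suc b)
    new : ∀ {a} e → e ≤ 3 → (a + e) % M ≡ 0 → Position a

  position : ∀ a → a < M → Position a
  position zero    _         = new 0 z≤n (0%n≡0 M)
  position (suc b) (s≤s b<m) with 4 + b ≤? m
  ... | yes 4+b≤m = old b 4+b≤m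
  ... | no 4+b≰m  = new (m ∸ b) m∸b≤3 (trans (cong (_% M) (cong suc (m+[n∸m]≡n (<⇒≤ b<m)))) (n%n≡0 M))
    where
    m∸b≤3 : m ∸ b ≤ 3
    m∸b≤3 = ≤-trans (∸-monoˡ-≤ b (s≤s⁻¹ (≰⇒> 4+b≰m))) (≤-reflexive (m+n∸n≡m 3 b))

  old<m : ∀ {b} → 4 + b ≤ m → b < m
  old<m {b} 4+b≤m = <-≤-trans (m<n+m b z<s) 4+b≤m

  old-window : ∀ {b} → 4 + b ≤ m → k < 4 + L → u (suc b + k) ≡ v (b + k)
  old-window {k} {b} 4+b≤m k<n = u-suc-wrapped (begin-strict
    b + k           <⟨ +-monoʳ-< b k<n ⟩
    b + (4 + L)     ≡⟨ +-assoc b 4 L ⟨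
    b + 4 + L       ≡⟨ cong (_+ L) (+-comm b 4) ⟩
    4 + b + L       ≤⟨ +-monoˡ-≤ L 4+b≤m ⟩
    m + L           ∎)
    where open ≤-Reasoning

  old-no-run : ∀ {b e} → 4 + b ≤ m → e ≤ 3 → ¬ Run u (suc L) (suc b + e)
  old-no-run {b} {e} 4+b≤m e≤3 run = 1+n≢0 (trans (sym (m<n⇒m%n≡m (s≤s 1+b+e≤m))) (to u-run run))
    where
    1+b+e≤m : suc b + e ≤ m
    1+b+e≤m = ≤-trans (+-monoʳ-≤ (suc b) e≤3) (≤-trans (≤-reflexive (cong suc (+-comm b 3))) 4+b≤m)

  new-same : ∀ {a b e} → a < M → b < M → e ≤ 3 → (b + e) % M ≡ 0 → SameWindow u (4 + L) a b → a ≡ b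
  new-same {a} {b} {e} a<M b<M e≤3 b+e≡0 same = %-injective a<M b<M (%-cancelʳ-+ {a} {b} M e (trans a+e≡0 (sym b+e≡0)))
    where
    a+e≡0 : (a + e) % M ≡ 0
    a+e≡0 = to u-run (SameWindow-Run u e same (+-monoˡ-≤ (suc L) e≤3) (from u-run b+e≡0))

  u-distinct : ∀ {a b} → a < M → b < M → SameWindow u (4 + L) a b → a ≡ b
  u-distinct {a} {b} a<M b<M same with position a a<M | position b b<M
  ... | old b₁ p | old b₂ q = cong suc (%-injective (old<m p) (old<m q) (v-distinct b₁ b₂ λ k k<n →
          trans (sym (old-window p k<n)) (trans (same k k<n) (old-window q k<n))))
  ... | _ | new e e≤3 b+e≡0 = new-same a<M b<M e≤3 b+e≡0 same
  ... | new e e≤3 a+e≡0 | _ = sym (new-same b<M a<M e≤3 a+e≡0 (SameWindow-sym u same))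

  mirror-run : ∀ {a b e} → e ≤ 3 → (b + e) % M ≡ 0 → ReversedWindow u (4 + L) a b → (a + (3 ∸ e)) % M ≡ 0
  mirror-run {a} {b} {e} e≤3 b+e≡0 rev = to u-run (subst (λ o → Run u (suc L) (a + o)) mirrored
    (ReversedWindow-Run u e rev (+-monoˡ-≤ (suc L) e≤3) (from u-run b+e≡0)))
    where
    mirrored : 4 + L ∸ (e + suc L) ≡ 3 ∸ e
    mirrored = trans (cong₂ _∸_ (+-comm 3 (suc L)) (+-comm e (suc L))) ([m+n]∸[m+o]≡n∸o (suc L) 3 e)

  -- Position e + L + 2 of the first window holds v (L + 1), the mirrored position holds v (m - 2).
  new-unreflected : ∀ {a b e} → e ≤ 1 → (a + e) % M ≡ 0 → (b + (3 ∸ e)) % M ≡ 0 → ¬ ReversedWindow u (4 + L) a b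
  new-unreflected {a} {b} {e} e≤1 a+e≡0 b+3∸e≡0 rev = v-ends-differ (sym (begin
    v (suc L)                           ≡⟨ u-suc (suc L) (≤-trans (m≤n+m (2 + L) 2) order≤period) ⟨
    u (0 + (2 + L))                     ≡⟨ cong (λ i → u (i + (2 + L))) a+e≡0 ⟨
    u ((a + e) % M + (2 + L))           ≡⟨ IsPeriod-%-+ u-periodic (a + e) (2 + L) ⟩
    u (a + e + (2 + L))                 ≡⟨ cong u (+-assoc a e (2 + L)) ⟩
    u (a + c)                           ≡⟨ rev c c<n ⟩
    u (b + (4 + L ∸ suc c))             ≡⟨ cong (λ i → u (b + i)) mirrored ⟩
    u (b + (1 ∸ e))                     ≡⟨ IsPeriod-cong u-periodic (%-cancelʳ-+ {b + (1 ∸ e)} {pred m} M 2 (trans b+3∸e (sym pred-m+2))) ⟩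
    u (pred m)                          ≡⟨ cong u suc[m∸2]≡pred[m] ⟨
    u (suc (m ∸ 2))                     ≡⟨ u-suc (m ∸ 2) (∸-monoʳ-< z<s 1<m) ⟩
    v (m ∸ 2)                           ∎))
    where
    open ≡-Reasoning
    c : ℕ
    c = e + (2 + L)
    c<n : c < 4 + L
    c<n = s≤s (+-monoˡ-≤ (2 + L) e≤1)
    mirrored : 4 + L ∸ suc c ≡ 1 ∸ e
    mirrored = trans (cong₂ _∸_ (+-comm 2 (2 + L)) (trans (cong suc (+-comm e (2 + L))) (sym (+-suc (2 + L) e))))
                     ([m+n]∸[m+o]≡n∸o (2 + L) 2 (suc e))
    b+3∸e : (b + (1 ∸ e) + 2) % M ≡ 0
    b+3∸e = trans (cong (_% M) (trans (+-assoc b (1 ∸ e) 2) (cong (b +_) (sym (+-∸-comm 2 e≤1))))) b+3∸e≡0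
    pred-m+2 : (pred m + 2) % M ≡ 0
    pred-m+2 = trans (cong (_% M) (trans (+-comm (pred m) 2) (cong suc (suc-pred m)))) (n%n≡0 M)

  new-asym : ∀ {a b eₐ e_b} → eₐ ≤ 3 → e_b ≤ 3 → (a + eₐ) % M ≡ 0 → (b + e_b) % M ≡ 0 →
             ¬ ReversedWindow u (4 + L) a b
  new-asym {a} {b} {eₐ} {e_b} eₐ≤3 e_b≤3 a+eₐ≡0 b+e_b≡0 rev with eₐ ≤? 1 | e_b ≤? 1
  ... | yes eₐ≤1 | _ = new-unreflected eₐ≤1 a+eₐ≡0 (mirror-run eₐ≤3 a+eₐ≡0 (ReversedWindow-sym u rev)) rev
  ... | no _ | yes e_b≤1 = new-unreflected e_b≤1 b+e_b≡0 (mirror-run e_b≤3 b+e_b≡0 rev) (ReversedWindow-sym u rev)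
  ... | no eₐ≰1 | no e_b≰1 = eₐ≰1 (subst (_≤ 1) (sym eₐ≡3∸e_b) (∸-monoʳ-≤ 3 (≰⇒> e_b≰1)))
    where
    eₐ≡3∸e_b : eₐ ≡ 3 ∸ e_b
    eₐ≡3∸e_b = %-injective (offset<M eₐ≤3) (offset<M (m∸n≤m 3 e_b))
      (%-cancelˡ-+ {eₐ} {3 ∸ e_b} M a (trans a+eₐ≡0 (sym (mirror-run e_b≤3 b+e_b≡0 rev))))

  u-asym : ∀ {a b} → a < M → b < M → ¬ ReversedWindow u (4 + L) a b
  u-asym {a} {b} a<M b<M rev with position a a<M | position b b<M
  ... | old b₁ p | old b₂ q = v-asym b₁ b₂ λ k k<n →
          trans (sym (old-window p k<n)) (trans (rev k k<n) (old-window q (reflect-< k<n)))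
  ... | old b₁ p | new e e≤3 b+e≡0 = old-no-run p (m∸n≤m 3 e) (from u-run (mirror-run e≤3 b+e≡0 rev))
  ... | new e e≤3 a+e≡0 | old b₂ q =
          old-no-run q (m∸n≤m 3 e) (from u-run (mirror-run e≤3 a+e≡0 (ReversedWindow-sym u rev)))
  ... | new eₐ eₐ≤3 a+eₐ≡0 | new e_b e_b≤3 b+e_b≡0 = new-asym eₐ≤3 e_b≤3 a+eₐ≡0 b+e_b≡0 rev

  u-orientable : Orientable (4 + L) M u
  u-orientable = orientable-from-residues u-periodic u-distinct u-asym

even-extension : ∀ L {m} s r → Orientable (4 + L) (suc m) s → r < suc m →
                 (∀ i → window s L i ≡ ones L ⇔ i % suc m ≡ r) →
                 Orientable (4 + L) (suc (suc m)) (insertOne s (suc m) r)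
even-extension L {m} s r s-orientable@((_ , s-periodic , _) , _) r<m unique =
  orientable-rotate (M ∸ r) (insertOne-periodic s (suc m) r) rotate-back (Extension.u-orientable
    (IsPeriod-rotate r s-periodic)
    (λ _ _ → orientable⇒SameWindow-residue v-orientable)
    (λ _ _ → orientable⇒¬ReversedWindow v-orientable)
    v-run
    (IsPeriod-rotate r (insertOne-periodic s (suc m) r))
    (insertOne-rotated-zero s-periodic r<m)
    (λ _ → insertOne-rotated-suc s-periodic r<m))
  where
  M : ℕ
  M = suc (suc m)
  t : BinSeq
  t = insertOne s (suc m) r
  v : BinSeq
  v x = s (r + x)
  v-orientable : Orientable (4 + L) (suc m) v
  v-orientable = orientable-rotate r (IsPeriod-rotate r s-periodic) (λ _ → refl) s-orientable
  v-run : ∀ x → Run v L x ⇔ x % suc m ≡ 0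
  v-run x = ⇔-trans (Run-rotate s r) (⇔-trans (⇔-sym (window-ones⇔Run s))
                                              (⇔-trans (unique (r + x)) (rotate-residue r<m)))
  rotate-back : ∀ x → t x ≡ t (r + (M ∸ r + x))
  rotate-back x = sym (begin
    t (r + (M ∸ r + x))   ≡⟨ cong t (+-assoc r (M ∸ r) x) ⟨
    t (r + (M ∸ r) + x)   ≡⟨ cong (λ y → t (y + x)) (m+[n∸m]≡n (<⇒≤ (m<n⇒m<1+n r<m))) ⟩
    t (M + x)             ≡⟨ cong t (+-comm M x) ⟩
    t (x + M)             ≡⟨ insertOne-periodic s (suc m) r x ⟩
    t x                   ∎)
    where open ≡-Reasoning

insertOne-orientable : ∀ {n m} s r → Orientable n (suc m) s → r < suc m →
                       (∀ i → window s (n ∸ 4) i ≡ ones (n ∸ 4) ⇔ i % suc m ≡ r) →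
                       Orientable n (suc (suc m)) (insertOne s (suc m) r)
insertOne-orientable {n} {m} s r s-orientable@((_ , s-periodic , _) , _) r<m unique with 4 ≤? n
... | no 4≰n = ⊥-elim (empty-run-not-unique {s = s} 1<m r<m
        (subst (λ k → ∀ i → window s k i ≡ ones k ⇔ i % suc m ≡ r) (m≤n⇒m∸n≡0 (<⇒≤ (≰⇒> 4≰n))) unique))
  where
  1<m : 1 < suc m
  1<m = 1<period {n = n} s-periodic (λ _ _ → orientable⇒¬ReversedWindow s-orientable)
... | yes 4≤n with n ∸ 4 | m+[n∸m]≡n 4≤n
...   | L | refl = even-extension L s r s-orientable r<m unique

lemma2 : (n m : ℕ) (s : BinSeq) → Orientable n m s →
    (r : ℕ) → r < m →
    (∀ i → (window s (n ∸ 4) i ≡ ones (n ∸ 4)) ⇔ (i % suc (m ∸ 1) ≡ r)) →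
    (weight s m % 2 ≡ 1 →
       Orientable n m (ext s m r) × weight (ext s m r) m % 2 ≡ 1) ×
    (weight s m % 2 ≡ 0 →
       Orientable n (suc m) (ext s m r) × weight (ext s m r) (suc m) % 2 ≡ 1)
lemma2 n zero s ((() , _) , _) _ _ _
lemma2 n (suc m) s s-orientable r r<m unique = odd , even
  where
  parity-choice : ∀ {w} → weight s (suc m) % 2 ≡ w → ext s (suc m) r ≡ (if w ≡ᵇ 1 then s else insertOne s (suc m) r)
  parity-choice = cong (λ w → if w ≡ᵇ 1 then s else insertOne s (suc m) r)
  odd : weight s (suc m) % 2 ≡ 1 → Orientable n (suc m) (ext s (suc m) r) × weight (ext s (suc m) r) (suc m) % 2 ≡ 1
  odd w-odd rewrite parity-choice w-odd = s-orientable , w-odd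
  even : weight s (suc m) % 2 ≡ 0 →
         Orientable n (suc (suc m)) (ext s (suc m) r) × weight (ext s (suc m) r) (suc (suc m)) % 2 ≡ 1
  even w-even rewrite parity-choice w-even =
    insertOne-orientable s r s-orientable r<m unique ,
    subst (λ w → w % 2 ≡ 1) (sym (weight-insertOne s (suc m) r (<⇒≤ r<m))) (even⇒suc-odd {weight s (suc m)} w-even)
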